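{- Let $K\subseteq\mathbb{Z}_{\ge 2}$ and let $K_0=\{k_1,\dots,k_n\}\subseteq K$ with $\alpha(K_0)=\alpha(K)$. Let $w$ be a positive integer. Then for all sufficiently large integers $v$ such that the pair $(v;w)$ is admissible, one can write $v-w=\sum_{k\in K_0}c_k(k-1)$ with nonnegative integers $c_k$ in such a way that, for each $i=1,\dots,n$, the pair $$\Big(\sum_{j=1}^{i}c_{k_j}(k_j-1)+w;\ \sum_{j=1}^{i-1}c_{k_j}(k_j-1)+w\Big)$$ is also admissible.
   Context: For $S\subseteq\mathbb{Z}_{\ge2}$, $\alpha(S):=\gcd\{k-1:k\in S\}$ and $\beta(S):=\gcd\{k(k-1):k\in S\}$. A pair $(v;w)$ of positive integers is admissible (for IPBDs with block sizes in $K$) if $v-1\equiv w-1\equiv 0\pmod{\alpha(K)}$ and $v(v-1)-w(w-1)\equiv 0\pmod{\beta(K)}$. -}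

module Defs where

open import Data.Nat using (ℕ; zero; suc; _+_; _*_; _∸_; _≤_)
open import Data.Nat.Divisibility using (_∣_)
open import Data.Fin using (Fin; zero; suc)
open import Data.Product using (_×_; ∃)
open import Relation.Binary.PropositionalEquality using (_≡_)
open import Data.Integer as ℤ using (ℤ; +_)
import Data.Integer.Divisibility as ℤD

IsGcdOf : (ℕ → Set) → ℕ → Set
IsGcdOf P d = (∀ x → P x → d ∣ x) × (∀ e → (∀ x → P x → e ∣ x) → e ∣ d)

IsAlpha : (ℕ → Set) → ℕ → Set
IsAlpha S d = IsGcdOf (λ x → ∃ λ k → S k × x ≡ k ∸ 1) d

IsBeta : (ℕ → Set) → ℕ → Set
IsBeta S d = IsGcdOf (λ x → ∃ λ k → S k × x ≡ k * (k ∸ 1)) d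

Admissible : (a b v w : ℕ) → Set
Admissible a b v w =
  1 ≤ v × 1 ≤ w × a ∣ (v ∸ 1) × a ∣ (w ∸ 1) ×
  (+ b) ℤD.∣ ((+ (v * (v ∸ 1))) ℤ.- (+ (w * (w ∸ 1))))

-- prefix sum: psum f m = f 0 + ... + f (m-1) (truncated at n)
psum : ∀ {n} → (Fin n → ℕ) → ℕ → ℕ
psum {zero} f m = 0
psum {suc n} f zero = 0
psum {suc n} f (suc m) = f zero + psum (λ j → f (suc j)) m

-- Write g_j = k_j - 1 ≥ 1 and f(x) = x(x - 1).  For positive g_0, …, g_n, every large D that is
--     divisible by gcd(g_0, …, g_n) can be written D = Σ c_j g_j so that for
--     each i the tail Σ_{j>i} c_j g_j is divisible by g_i + 1.  By induction
--     on n: with A = gcd(g_1, …, g_n) and M = (g_0 + 1)A, solve the linear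
--     congruence c_0 g_0 ≡ D (mod M) with c_0 < M (Bézout) and represent the
--     multiple D - c_0 g_0 of M by the induction hypothesis.
-- (2) Quadratic splitting.  If b ∣ g(g + 1) and (g + 1) ∣ R, then
--     f(cg + R + w) ≡ f(w) (mod b) implies f(cg + w) ≡ f(w) (mod b), because
--     f(cg + w) - f(w) + g (f(cg + R + w) - f(w)) is a multiple of g(g + 1).
-- (3) Admissible chain.  Peeling off the first block with (2) and recursing
--     with w replaced by c_0 g_0 + w makes every consecutive pair admissible,
--     since α(K₀) ∣ g_j and β(K) ∣ k_j(k_j - 1).
-- The theorem applies (1) to D = v - w, which is divisible by
-- gcd(g_j) = α(K₀) by admissibility of (v; w), and concludes with (3).
module Submission where

open import Defs
open import Data.Nat using (ℕ; zero; suc; _+_; _*_; _∸_; _≤_; _<_; z<s)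
open import Data.Nat.Properties
open import Data.Nat.Divisibility
  using (_∣_; divides; ∣-trans; _∣0; 0∣⇒≡0; ∣m+n∣m⇒∣n; ∣m∣n⇒∣m+n; m∣m*n; n∣m*n)
open import Data.Nat.DivMod using (_%_; _/_; m%n<n; m≡m%n+[m/n]*n)
open import Data.Nat.GCD using (gcd; gcd[m,n]∣m; gcd[m,n]∣n; gcd-greatest; gcd-GCD; module Bézout)
open import Data.Fin using (Fin; toℕ; zero; suc)
open import Data.Product using (_×_; _,_; proj₁; proj₂; ∃; ∃₂; Σ)
open import Data.Unit using (⊤; tt)
open import Relation.Binary.PropositionalEquality
open import Relation.Nullary using (contradiction)
open import Function.Definitions using (Injective)
open import Data.Integer as ℤ using (ℤ; +_; 1ℤ)
import Data.Integer.Properties as ℤP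
import Data.Integer.Divisibility as ℤD
import Data.Integer.Divisibility.Signed as ℤS
import Data.Nat.Tactic.RingSolver as ℕRing
import Data.Integer.Tactic.RingSolver as ℤRing

-- x ≡ y (mod M), stated additively so that no truncated subtraction occurs.
_≡_[mod_] : ℕ → ℕ → ℕ → Set
x ≡ y [mod M ] = ∃₂ λ a₁ a₂ → x + M * a₁ ≡ y + M * a₂

congruent⇒∣∸ : ∀ {M D E} → D ≡ E [mod M ] → E ≤ D → M ∣ D ∸ E
congruent⇒∣∸ {M} {D} {E} (a₁ , a₂ , eq) E≤D = ∣m+n∣m⇒∣n M∣a₁M+[D∸E] (m∣m*n a₁)
  where
  open ≡-Reasoning
  [D∸E]+a₁M≡a₂M : (D ∸ E) + M * a₁ ≡ M * a₂
  [D∸E]+a₁M≡a₂M = +-cancelˡ-≡ E _ _ (begin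
    E + ((D ∸ E) + M * a₁) ≡⟨ +-assoc E (D ∸ E) (M * a₁) ⟨
    (E + (D ∸ E)) + M * a₁ ≡⟨ cong (_+ M * a₁) (m+[n∸m]≡n E≤D) ⟩
    D + M * a₁             ≡⟨ eq ⟩
    E + M * a₂             ∎)
  M∣a₁M+[D∸E] : M ∣ M * a₁ + (D ∸ E)
  M∣a₁M+[D∸E] = subst (M ∣_) (trans (sym [D∸E]+a₁M≡a₂M) (+-comm (D ∸ E) (M * a₁))) (m∣m*n a₂)

bézout-congruence : ∀ g m D → gcd g (suc m) ∣ D → ∃ λ u → D ≡ u * g [mod suc m ]
bézout-congruence g m D (divides q refl) with Bézout.identity (gcd-GCD g (suc m))
... | Bézout.+- x y d+yM≡xg = x * q , y * q , 0 , (begin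
    q * d + M * (y * q) ≡⟨ factor q d y M ⟩
    q * (d + y * M)     ≡⟨ cong (q *_) d+yM≡xg ⟩
    q * (x * g)         ≡⟨ regroup q x g M ⟩
    x * q * g + M * 0   ∎)
  where
  open ≡-Reasoning
  M = suc m
  d = gcd g M
  factor : ∀ q d y M → q * d + M * (y * q) ≡ q * (d + y * M)
  factor = ℕRing.solve-∀
  regroup : ∀ q x g M → q * (x * g) ≡ x * q * g + M * 0
  regroup = ℕRing.solve-∀
... | Bézout.-+ x y d+xg≡yM = m * x * q , x * q * g , q * y , (begin
    q * d + suc m * (x * q * g)         ≡⟨ expand q d x g m ⟩
    q * (d + x * g) + m * x * q * g     ≡⟨ cong (λ z → q * z + m * x * q * g) d+xg≡yM ⟩
    q * (y * suc m) + m * x * q * g     ≡⟨ regroup q y m x g ⟩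
    m * x * q * g + suc m * (q * y)     ∎)
  where
  open ≡-Reasoning
  d = gcd g (suc m)
  expand : ∀ q d x g m → q * d + suc m * (x * q * g) ≡ q * (d + x * g) + m * x * q * g
  expand = ℕRing.solve-∀
  regroup : ∀ q y m x g → q * (y * suc m) + m * x * q * g ≡ m * x * q * g + suc m * (q * y)
  regroup = ℕRing.solve-∀

linear-congruence : ∀ g M D → 0 < M → gcd g M ∣ D → ∃ λ c → c < M × D ≡ c * g [mod M ]
linear-congruence g (suc m) D z<s gcd∣D with bézout-congruence g m D gcd∣D
... | u , a₁ , a₂ , eq = u % M , m%n<n u M , a₁ , a₂ + u / M * g , (begin
    D + M * a₁                       ≡⟨ eq ⟩
    u * g + M * a₂                   ≡⟨ cong (λ z → z * g + M * a₂) (m≡m%n+[m/n]*n u M) ⟩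
    (u % M + u / M * M) * g + M * a₂ ≡⟨ regroup (u % M) (u / M) M g a₂ ⟩
    u % M * g + M * (a₂ + u / M * g) ∎)
  where
  open ≡-Reasoning
  M = suc m
  regroup : ∀ r s M g a → (r + s * M) * g + M * a ≡ r * g + M * (a + s * g)
  regroup = ℕRing.solve-∀

total : ∀ {n} → (Fin n → ℕ) → ℕ
total {n} f = psum f n

psum-zero : ∀ {n} (f : Fin n → ℕ) → psum f 0 ≡ 0
psum-zero {zero} f = refl
psum-zero {suc n} f = refl

gcdAll : ∀ n → (Fin (suc n) → ℕ) → ℕ
gcdAll zero g = g zero
gcdAll (suc n) g = gcd (g zero) (gcdAll n (λ j → g (suc j)))

gcdAll∣ : ∀ n g (j : Fin (suc n)) → gcdAll n g ∣ g j
gcdAll∣ zero g zero = divides 1 (sym (+-identityʳ (g zero)))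
gcdAll∣ (suc n) g zero = gcd[m,n]∣m (g zero) _
gcdAll∣ (suc n) g (suc j) = ∣-trans (gcd[m,n]∣n (g zero) _) (gcdAll∣ n (λ j → g (suc j)) j)

gcdAll>0 : ∀ n g → 0 < g zero → 0 < gcdAll n g
gcdAll>0 n g g₀>0 with gcdAll n g | gcdAll∣ n g zero
... | zero  | 0∣g₀ = contradiction (subst (0 <_) (0∣⇒≡0 0∣g₀) g₀>0) n≮0
... | suc _ | _    = z<s

-- gcd(g, (1 + g)A) divides gcd(g, A), as (1 + g)A = A + gA.
gcd-absorb : ∀ g A → gcd g (suc g * A) ∣ gcd g A
gcd-absorb g A = gcd-greatest (gcd[m,n]∣m g _) d∣A
  where
  d∣A : gcd g (suc g * A) ∣ A
  d∣A = ∣m+n∣m⇒∣n (subst (gcd g (suc g * A) ∣_) (+-comm A (g * A)) (gcd[m,n]∣n g _))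
                   (∣-trans (gcd[m,n]∣m g _) (m∣m*n A))

Staged : ∀ {n} → (Fin n → ℕ) → (Fin n → ℕ) → Set
Staged {zero} g c = ⊤
Staged {suc n} g c =
  suc (g zero) ∣ total (λ j → c (suc j) * g (suc j)) × Staged (λ j → g (suc j)) (λ j → c (suc j))

staged-representation : ∀ n (g : Fin (suc n) → ℕ) → (∀ j → 0 < g j) →
  ∃ λ N → ∀ D → N ≤ D → gcdAll n g ∣ D →
    Σ (Fin (suc n) → ℕ) λ c → total (λ j → c j * g j) ≡ D × Staged g c
staged-representation zero g _ = 0 , λ { D _ (divides q D≡qg₀) →
  (λ _ → q) , trans (+-identityʳ _) (sym D≡qg₀) , (_ ∣0) , tt }
staged-representation (suc n) g g>0 = N′ + M * g₀ , represent
  where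
  g₀ = g zero
  tail = λ (j : Fin (suc n)) → g (suc j)
  A = gcdAll n tail
  M = suc g₀ * A
  M>0 : 0 < M
  M>0 = *-mono-< {0} {suc g₀} {0} {A} z<s (gcdAll>0 n tail (g>0 (suc zero)))
  IH = staged-representation n tail (λ j → g>0 (suc j))
  N′ = proj₁ IH
  represent : ∀ D → N′ + M * g₀ ≤ D → gcdAll (suc n) g ∣ D →
    Σ (Fin (suc (suc n)) → ℕ) λ c → total (λ j → c j * g j) ≡ D × Staged g c
  represent D N≤D gcd∣D with linear-congruence g₀ M D M>0 (∣-trans (gcd-absorb g₀ A) gcd∣D)
  ... | c₀ , c₀<M , D≡c₀g₀ = cons , sum≡D , g₀+1∣D′ , staged
    where
    c₀g₀≤M*g₀ : c₀ * g₀ ≤ M * g₀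
    c₀g₀≤M*g₀ = *-monoˡ-≤ g₀ (<⇒≤ c₀<M)
    c₀g₀≤D : c₀ * g₀ ≤ D
    c₀g₀≤D = ≤-trans c₀g₀≤M*g₀ (m+n≤o⇒n≤o N′ N≤D)
    D′ = D ∸ c₀ * g₀
    M∣D′ : M ∣ D′
    M∣D′ = congruent⇒∣∸ D≡c₀g₀ c₀g₀≤D
    -- D′ is large and a multiple of M, hence of A: represent it by induction.
    rest = proj₂ IH D′ (m+n≤o⇒m≤o∸n N′ (≤-trans (+-monoʳ-≤ N′ c₀g₀≤M*g₀) N≤D))
                       (∣-trans (n∣m*n (suc g₀)) M∣D′)
    cons : Fin (suc (suc n)) → ℕ
    cons zero = c₀
    cons (suc j) = proj₁ rest j
    sum≡D : c₀ * g₀ + total (λ j → proj₁ rest j * tail j) ≡ D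
    sum≡D = trans (cong (λ s → c₀ * g₀ + s) (proj₁ (proj₂ rest))) (m+[n∸m]≡n c₀g₀≤D)
    g₀+1∣D′ : suc g₀ ∣ total (λ j → proj₁ rest j * tail j)
    g₀+1∣D′ = subst (suc g₀ ∣_) (sym (proj₁ (proj₂ rest))) (∣-trans (m∣m*n A) M∣D′)
    staged = proj₂ (proj₂ rest)

quad : ℤ → ℤ
quad X = X ℤ.* (X ℤ.- 1ℤ)

QuadCong : ℕ → ℕ → ℕ → Set
QuadCong b x y = + b ℤD.∣ (+ (x * (x ∸ 1)) ℤ.- + (y * (y ∸ 1)))

pos-quad : ∀ x → + (x * (x ∸ 1)) ≡ quad (+ x)
pos-quad zero = refl
pos-quad (suc x) = ℤP.pos-* (suc x) x

quadCong⇒∣ : ∀ {b x y X Y} → + x ≡ X → + y ≡ Y → QuadCong b x y → + b ℤS.∣ (quad X ℤ.- quad Y)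
quadCong⇒∣ {b} {x} {y} refl refl x~y =
  subst₂ (λ P Q → + b ℤS.∣ (P ℤ.- Q)) (pos-quad x) (pos-quad y) (ℤS.∣ᵤ⇒∣ x~y)

∣⇒quadCong : ∀ {b x y X Y} → + x ≡ X → + y ≡ Y → + b ℤS.∣ (quad X ℤ.- quad Y) → QuadCong b x y
∣⇒quadCong {b} {x} {y} refl refl b∣ =
  ℤS.∣⇒∣ᵤ (subst₂ (λ P Q → + b ℤS.∣ (P ℤ.- Q)) (sym (pos-quad x)) (sym (pos-quad y)) b∣)

quadCong-between : ∀ {b x y z} → QuadCong b x z → QuadCong b y z → QuadCong b x y
quadCong-between {b} {x} {y} {z} x~z y~z =
  ℤS.∣⇒∣ᵤ (subst (+ b ℤS.∣_) (cancel X Y Z)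
    (ℤS.∣m∣n⇒∣m-n (ℤS.∣ᵤ⇒∣ {i = X ℤ.- Z} x~z) (ℤS.∣ᵤ⇒∣ {i = Y ℤ.- Z} y~z)))
  where
  X = + (x * (x ∸ 1))
  Y = + (y * (y ∸ 1))
  Z = + (z * (z ∸ 1))
  cancel : ∀ X Y Z → (X ℤ.- Z) ℤ.- (Y ℤ.- Z) ≡ X ℤ.- Y
  cancel = ℤRing.solve-∀

split-identity : ∀ C G T W →
  quad (C ℤ.* G ℤ.+ W) ℤ.- quad W ≡
  (1ℤ ℤ.+ G) ℤ.* G ℤ.* (C ℤ.* (W ℤ.+ W ℤ.+ C ℤ.* G ℤ.- 1ℤ) ℤ.+
                        T ℤ.* (W ℤ.+ W ℤ.+ C ℤ.* G ℤ.+ C ℤ.* G ℤ.+ T ℤ.* (1ℤ ℤ.+ G) ℤ.- 1ℤ))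
  ℤ.- G ℤ.* (quad (C ℤ.* G ℤ.+ T ℤ.* (1ℤ ℤ.+ G) ℤ.+ W) ℤ.- quad W)
split-identity = expanded
  where
  expanded : ∀ C G T W →
    (C ℤ.* G ℤ.+ W) ℤ.* (C ℤ.* G ℤ.+ W ℤ.- 1ℤ) ℤ.- W ℤ.* (W ℤ.- 1ℤ) ≡
    (1ℤ ℤ.+ G) ℤ.* G ℤ.* (C ℤ.* (W ℤ.+ W ℤ.+ C ℤ.* G ℤ.- 1ℤ) ℤ.+
                          T ℤ.* (W ℤ.+ W ℤ.+ C ℤ.* G ℤ.+ C ℤ.* G ℤ.+ T ℤ.* (1ℤ ℤ.+ G) ℤ.- 1ℤ))
    ℤ.- G ℤ.* ((C ℤ.* G ℤ.+ T ℤ.* (1ℤ ℤ.+ G) ℤ.+ W) ℤ.* (C ℤ.* G ℤ.+ T ℤ.* (1ℤ ℤ.+ G) ℤ.+ W ℤ.- 1ℤ)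
               ℤ.- W ℤ.* (W ℤ.- 1ℤ))
  expanded = ℤRing.solve-∀

quadCong-split : ∀ {b} g c R w → b ∣ suc g * g → suc g ∣ R →
  QuadCong b (c * g + R + w) w → QuadCong b (c * g + w) w
quadCong-split {b} g c .(t * suc g) w b∣[g+1]g (divides t refl) hq =
  ∣⇒quadCong {x = c * g + w} {y = w} (cong (ℤ._+ W) (ℤP.pos-* c g)) refl
    (subst (+ b ℤS.∣_) (sym (split-identity C G T W))
      (ℤS.∣m∣n⇒∣m-n (ℤS.∣m⇒∣m*n _ b∣[1+G]G) (ℤS.∣n⇒∣m*n G hq′)))
  where
  C = + c
  G = + g
  T = + t
  W = + w
  b∣[1+G]G : + b ℤS.∣ (1ℤ ℤ.+ G) ℤ.* G
  b∣[1+G]G = subst (+ b ℤS.∣_) (ℤP.pos-* (suc g) g) (ℤS.∣ᵤ⇒∣ b∣[g+1]g)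
  hq′ : + b ℤS.∣ (quad (C ℤ.* G ℤ.+ T ℤ.* (1ℤ ℤ.+ G) ℤ.+ W) ℤ.- quad W)
  hq′ = quadCong⇒∣ {x = c * g + t * suc g + w} {y = w}
          (cong₂ (λ P Q → P ℤ.+ Q ℤ.+ W) (ℤP.pos-* c g) (ℤP.pos-* t (suc g))) refl hq

α-shift : ∀ {a} x w → 1 ≤ w → a ∣ x → a ∣ w ∸ 1 → a ∣ x + w ∸ 1
α-shift {a} x w 1≤w a∣x a∣w-1 = subst (a ∣_) (sym (+-∸-assoc x 1≤w)) (∣m∣n⇒∣m+n a∣x a∣w-1)

admissible-chain : ∀ n (g c : Fin n → ℕ) {a b w} →
  (∀ j → a ∣ g j) → (∀ j → b ∣ suc (g j) * g j) → Staged g c →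
  1 ≤ w → a ∣ w ∸ 1 → QuadCong b (total (λ j → c j * g j) + w) w →
  (i : Fin n) → Admissible a b (psum (λ j → c j * g j) (suc (toℕ i)) + w)
                               (psum (λ j → c j * g j) (toℕ i) + w)
admissible-chain (suc n) g c {a} {b} {w} a∣g b∣g (g₀+1∣R , staged) 1≤w a∣w-1 hq = λ
  { zero    → first-step
  ; (suc i) → subst₂ (Admissible a b) (shift _ x₀ w) (shift _ x₀ w) (later-steps i)
  }
  where
  swap : ∀ x r w → x + r + w ≡ r + (x + w)
  swap = ℕRing.solve-∀
  shift : ∀ p x w → p + (x + w) ≡ x + p + w
  shift = ℕRing.solve-∀
  x₀ = c zero * g zero
  tail = λ (j : Fin n) → c (suc j) * g (suc j)
  R = total tail
  a∣x₀ : a ∣ x₀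
  a∣x₀ = ∣-trans (a∣g zero) (n∣m*n (c zero))
  x₀+w≥1 : 1 ≤ x₀ + w
  x₀+w≥1 = ≤-trans 1≤w (m≤n+m w x₀)
  x₀+w~w : QuadCong b (x₀ + w) w
  x₀+w~w = quadCong-split (g zero) (c zero) R w (b∣g zero) g₀+1∣R hq
  R+x₀+w~x₀+w : QuadCong b (R + (x₀ + w)) (x₀ + w)
  R+x₀+w~x₀+w = quadCong-between {x = R + (x₀ + w)} {y = x₀ + w} {z = w}
    (subst (λ v → QuadCong b v w) (swap x₀ R w) hq) x₀+w~w
  first-step : Admissible a b (x₀ + psum tail 0 + w) w
  first-step rewrite psum-zero tail | +-identityʳ x₀ =
    x₀+w≥1 , 1≤w , α-shift x₀ w 1≤w a∣x₀ a∣w-1 , a∣w-1 , x₀+w~w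
  later-steps : (i : Fin n) → Admissible a b (psum tail (suc (toℕ i)) + (x₀ + w))
                                             (psum tail (toℕ i) + (x₀ + w))
  later-steps = admissible-chain n (λ j → g (suc j)) (λ j → c (suc j))
    (λ j → a∣g (suc j)) (λ j → b∣g (suc j)) staged
    x₀+w≥1 (α-shift x₀ w 1≤w a∣x₀ a∣w-1) R+x₀+w~x₀+w

∣∸-of-preds : ∀ {a v w} → 1 ≤ w → w ≤ v → a ∣ v ∸ 1 → a ∣ w ∸ 1 → a ∣ v ∸ w
∣∸-of-preds {a} {v} {w} 1≤w w≤v a∣v-1 a∣w-1 = ∣m+n∣m⇒∣n (subst (a ∣_) v-1≡ a∣v-1) a∣w-1
  where
  v-1≡ : v ∸ 1 ≡ (w ∸ 1) + (v ∸ w)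
  v-1≡ = trans (cong (_∸ 1) (sym (m+[n∸m]≡n w≤v))) (+-∸-comm (v ∸ w) 1≤w)

-- α of the empty family is 0, so admissibility forces v = w (= 1).
empty-family : ∀ {ks : Fin 0 → ℕ} {a b v w} → IsAlpha (λ k → ∃ λ j → ks j ≡ k) a →
  Admissible a b v w → v ≡ w
empty-family {a = a} (_ , greatest) (1≤v , 1≤w , a∣v-1 , a∣w-1 , _) =
  trans (is-one 1≤v a∣v-1) (sym (is-one 1≤w a∣w-1))
  where
  a≡0 : a ≡ 0
  a≡0 = 0∣⇒≡0 (greatest 0 λ { _ (_ , (() , _) , _) })
  is-one : ∀ {x} → 1 ≤ x → a ∣ x ∸ 1 → x ≡ 1
  is-one 1≤x a∣x-1 = ≤-antisym (m∸n≡0⇒m≤n (0∣⇒≡0 (subst (_∣ _) a≡0 a∣x-1))) 1≤x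

AdmissibleDecomposition : ∀ {n} → ℕ → ℕ → (Fin n → ℕ) → ℕ → ℕ → Set
AdmissibleDecomposition {n} a b g v w =
  Σ (Fin n → ℕ) λ c →
    (v ≡ psum (λ j → c j * g j) n + w) ×
    ((i : Fin n) → Admissible a b (psum (λ j → c j * g j) (suc (toℕ i)) + w)
                                  (psum (λ j → c j * g j) (toℕ i) + w))

admissible-decomposition : ∀ m (g : Fin (suc m) → ℕ) {a b} →
  (∀ j → 0 < g j) → (∀ j → a ∣ g j) → (∀ j → b ∣ suc (g j) * g j) → gcdAll m g ∣ a →
  ∀ w → 1 ≤ w → ∃ λ N → ∀ v → N ≤ v → Admissible a b v w → AdmissibleDecomposition a b g v w
admissible-decomposition m g {a} {b} g>0 a∣g b∣g gcd∣a w 1≤w = N + w , decompose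
  where
  N = proj₁ (staged-representation m g g>0)
  decompose : ∀ v → N + w ≤ v → Admissible a b v w → AdmissibleDecomposition a b g v w
  decompose v N+w≤v (_ , _ , a∣v-1 , a∣w-1 , v~w) =
    c , v≡ , admissible-chain (suc m) g c a∣g b∣g staged 1≤w a∣w-1
               (subst (λ u → QuadCong b u w) v≡ v~w)
    where
    w≤v = m+n≤o⇒n≤o N N+w≤v
    representation = proj₂ (staged-representation m g g>0) (v ∸ w) (m+n≤o⇒m≤o∸n N N+w≤v)
                       (∣-trans gcd∣a (∣∸-of-preds 1≤w w≤v a∣v-1 a∣w-1))
    c = proj₁ representation
    staged = proj₂ (proj₂ representation)
    v≡ : v ≡ total (λ j → c j * g j) + w
    v≡ = trans (sym (m∸n+n≡m w≤v)) (cong (λ s → s + w) (sym (proj₁ (proj₂ representation))))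

lemma4p5 : (K : ℕ → Set) → (∀ k → K k → 2 ≤ k) →
    (n : ℕ) (ks : Fin n → ℕ) → Injective _≡_ _≡_ ks → (∀ j → K (ks j)) →
    (a b : ℕ) → IsAlpha K a → IsBeta K b → IsAlpha (λ k → ∃ λ j → ks j ≡ k) a →
    (w : ℕ) → 1 ≤ w →
    ∃ λ N → ∀ v → N ≤ v → Admissible a b v w →
      Σ (Fin n → ℕ) λ c →
        (v ≡ psum {n} (λ j → c j * (ks j ∸ 1)) n + w) ×
        ((i : Fin n) → Admissible a b (psum {n} (λ j → c j * (ks j ∸ 1)) (suc (toℕ i)) + w)
                              (psum {n} (λ j → c j * (ks j ∸ 1)) (toℕ i) + w))
lemma4p5 _ _ zero ks _ _ a b _ _ α₀ w _ =
  0 , λ v _ adm → (λ ()) , empty-family {ks = ks} α₀ adm , λ ()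
lemma4p5 _ K≥2 (suc m) ks _ ks∈K a b _ βK α₀ w 1≤w =
  admissible-decomposition m g g>0 a∣g b∣g gcd∣a w 1≤w
  where
  g : Fin (suc m) → ℕ
  g j = ks j ∸ 1
  g>0 : ∀ j → 0 < g j
  g>0 j = ∸-monoˡ-≤ 1 (K≥2 (ks j) (ks∈K j))
  g+1≡k : ∀ j → suc (g j) ≡ ks j
  g+1≡k j = m+[n∸m]≡n (≤-trans (n≤1+n 1) (K≥2 (ks j) (ks∈K j)))
  a∣g : ∀ j → a ∣ g j
  a∣g j = proj₁ α₀ (g j) (ks j , (j , refl) , refl)
  b∣g : ∀ j → b ∣ suc (g j) * g j
  b∣g j = subst (λ k → b ∣ k * g j) (sym (g+1≡k j)) (proj₁ βK _ (ks j , ks∈K j , refl))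
  gcd∣a : gcdAll m g ∣ a
  gcd∣a = proj₂ α₀ _ λ { _ (_ , (j , refl) , refl) → gcdAll∣ m g j }
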